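{- For $n\ge1$ and $0\le j,k\le n$: if $0\le j<n$ then \[B(n,k,j)=\frac{(k+1)n}{n-j}B(n-1,k,j)+\frac{(n-k)n}{n-j}B(n-1,k-1,j),\] and if $0<j\le n$ then \[B(n,k,j)=\frac{kn}{j}B(n-1,k,j-1)+\frac{(n-k+1)n}{j}B(n-1,k-1,j-1).\]
   Context: $\mathcal{B}_n$ is the set of signed permutations of order $n$: bijections $\sigma$ of $\{ -n,\ldots,n\}$ with $\sigma(-i)=-\sigma(i)$, identified with $(0,\sigma_1,\ldots,\sigma_n)$. $\mathrm{des}(\sigma)$ is the number of $i\in\{1,\ldots,n\}$ with $\sigma_{i-1}>\sigma_i$ ($\sigma_0=0$), $\mathrm{neg}(\sigma)$ the number of $i\in\{1,\ldots,n\}$ with $\sigma_i<0$. $B(n,k,j)$ is the number of $\sigma\in\mathcal{B}_n$ with $\mathrm{des}(\sigma)=k$ and $\mathrm{neg}(\sigma)=j$; $B(m,k,j)=0$ if $k$ or $j$ lies outside $\{0,\ldots,m\}$. -}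

module Defs where

open import Data.Nat as ℕ using (ℕ; zero; suc; _+_)
open import Data.Integer as ℤ using (ℤ; +_; -[1+_]; ∣_∣)
open import Data.Integer.Properties as ℤP using ()
open import Data.List using (List; []; _∷_; map; concatMap; filter; length; upTo)
open import Data.Bool using (Bool; true; false; if_then_else_)
open import Data.Product using (_×_)
open import Relation.Nullary using (does)
open import Relation.Nullary.Decidable using (_×-dec_)
open import Data.List.Relation.Unary.Unique.DecPropositional ℕ._≟_ using (unique?)

entries : ℕ → List ℤ
entries n = map (λ i → + suc i) (upTo n) Data.List.++ map (λ i → -[1+ i ]) (upTo n)

words : ℕ → List ℤ → List (List ℤ)
words zero    xs = [] ∷ []
words (suc m) xs = concatMap (λ x → map (x ∷_) (words m xs)) xs

-- Signed permutations of order n, written in window notation (σ₁,…,σₙ):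
-- words of length n over {±1,…,±n} whose absolute values are pairwise
-- distinct (hence |σ₁|,…,|σₙ| is a permutation of 1,…,n).
signedPerms : ℕ → List (List ℤ)
signedPerms n = filter (λ w → unique? (map ∣_∣ w)) (words n (entries n))

desFrom : ℤ → List ℤ → ℕ
desFrom p []       = 0
desFrom p (x ∷ xs) = (if does (x ℤ.<? p) then 1 else 0) + desFrom x xs

des : List ℤ → ℕ
des w = desFrom (+ 0) w

neg : List ℤ → ℕ
neg w = length (filter (λ x → x ℤ.<? + 0) w)

B : ℕ → ℕ → ℕ → ℕ
B n k j = length (filter (λ w → (des w ℕ.≟ k) ×-dec (neg w ℕ.≟ j)) (signedPerms n))

-- B with integer indices, 0 when an index is negative (the paper's convention
-- B(m,k,j) = 0 for k or j outside {0,…,m}; the upper range is automatic).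
Bℤ : ℕ → ℤ → ℤ → ℕ
Bℤ n (+ k) (+ j) = B n k j
Bℤ n _     _     = 0

-- Reading a signed permutation from left to right, the number of ways to finish it
-- depends only on how many absolute values are still unused and on the rank of the
-- last letter among the unused signed letters; this gives a transfer recursion
-- (Completions) with B(n,k,j) = Completions n n.  Whatever the rank, the tables for
-- n + 1 unused values arise from those for n by one and the same four-term recurrence
-- (NextRow).  It is also satisfied by (n C j) · f(n,j,k), where f(n,j,·) arises from
-- f(n−1,j,·) by the Eulerian recurrence for inserting a positive letter (a negative one
-- when j = n); hence B(n,k,j) = (n C j) · f(n,j,k).  Inserting a positive and a
-- negative letter commute, so f obeys a recurrence of either kind, and the absorption
-- identities (n − j)(n C j) = n (n−1 C j) and j (n C j) = n (n−1 C j−1) turn these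
-- into the two recurrences of the corollary.

module Submission where

open import Data.Bool using (Bool; true; false; if_then_else_; T; _∧_; _∨_; not)
open import Data.Bool.ListAction using (all)
open import Data.Bool.Properties using (∧-zeroʳ)
open import Data.Integer as ℤ using (ℤ; +_; -[1+_]; ∣_∣; _-_)
open import Data.List using (List; []; _∷_; map; filter; length; upTo; applyUpTo; concatMap; _++_)
open import Data.List.Properties using (map-++; map-∘; map-cong)
open import Data.List.Relation.Unary.All using (all?)
open import Data.Nat
open import Data.Nat.Combinatorics using (_C_; nC1≡n; k>n⇒nCk≡0; nCk+nC[k+1]≡[n+1]C[k+1])
open import Data.Nat.ListAction using (sum)
open import Data.Nat.ListAction.Properties using (sum-++)
open import Data.Nat.Properties
open import Data.List.Relation.Unary.Unique.DecPropositional _≟_ using (unique?)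
open import Data.Nat.Tactic.RingSolver using (solve-∀)
open import Data.Product using (_×_; _,_)
open import Data.Sum using (_⊎_; inj₁; inj₂)
open import Data.Unit using (tt)
open import Function using (_∘_)
open import Relation.Binary using (tri<; tri≈; tri>)
open import Relation.Binary.PropositionalEquality
open import Relation.Nullary using (Dec; does; ¬?; yes; no; contradiction)

open import Defs

<ᵇ-true : ∀ {m n} → m < n → (m <ᵇ n) ≡ true
<ᵇ-true {zero}  {suc n} _         = refl
<ᵇ-true {suc m} {suc n} (s≤s m<n) = <ᵇ-true m<n

<ᵇ-false : ∀ {m n} → n ≤ m → (m <ᵇ n) ≡ false
<ᵇ-false z≤n       = refl
<ᵇ-false (s≤s n≤m) = <ᵇ-false n≤m

≤ᵇ-true : ∀ {m n} → m ≤ n → (m ≤ᵇ n) ≡ true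
≤ᵇ-true z≤n       = refl
≤ᵇ-true (s≤s m≤n) = <ᵇ-true (s≤s m≤n)

≡ᵇ-refl : ∀ a → (a ≡ᵇ a) ≡ true
≡ᵇ-refl zero    = refl
≡ᵇ-refl (suc a) = ≡ᵇ-refl a

≡ᵇ-false : ∀ {a b} → a ≢ b → (a ≡ᵇ b) ≡ false
≡ᵇ-false {zero}  {zero}  a≢b = contradiction refl a≢b
≡ᵇ-false {zero}  {suc b} a≢b = refl
≡ᵇ-false {suc a} {zero}  a≢b = refl
≡ᵇ-false {suc a} {suc b} a≢b = ≡ᵇ-false (a≢b ∘ cong suc)

-- Finite sums

Σ< : ℕ → (ℕ → ℕ) → ℕ
Σ< zero    f = 0
Σ< (suc n) f = f 0 + Σ< n (λ i → f (suc i))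

Σ<-cong : ∀ n {f g : ℕ → ℕ} → (∀ i → i < n → f i ≡ g i) → Σ< n f ≡ Σ< n g
Σ<-cong zero    f≡g = refl
Σ<-cong (suc n) f≡g = cong₂ _+_ (f≡g 0 z<s) (Σ<-cong n (λ i i<n → f≡g (suc i) (s<s i<n)))

Σ<-zero : ∀ n → Σ< n (λ _ → 0) ≡ 0
Σ<-zero zero    = refl
Σ<-zero (suc n) = Σ<-zero n

Σ<-snoc : ∀ n (f : ℕ → ℕ) → Σ< (suc n) f ≡ Σ< n f + f n
Σ<-snoc zero    f = +-comm (f 0) 0
Σ<-snoc (suc n) f =
  trans (cong (_+_ (f 0)) (Σ<-snoc n (λ i → f (suc i)))) (sym (+-assoc (f 0) _ _))

Σ<-split : ∀ a b (f : ℕ → ℕ) → Σ< (a + b) f ≡ Σ< a f + Σ< b (λ i → f (a + i))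
Σ<-split zero    b f = refl
Σ<-split (suc a) b f =
  trans (cong (_+_ (f 0)) (Σ<-split a b (λ i → f (suc i)))) (sym (+-assoc (f 0) _ _))

Σ<-+ : ∀ n (f g : ℕ → ℕ) → Σ< n (λ i → f i + g i) ≡ Σ< n f + Σ< n g
Σ<-+ zero    f g = refl
Σ<-+ (suc n) f g =
  trans (cong (_+_ (f 0 + g 0)) (Σ<-+ n _ _)) (interchange (f 0) (g 0) _ _)
  where
  interchange : ∀ a b c d → (a + b) + (c + d) ≡ (a + c) + (b + d)
  interchange = solve-∀

𝟙 : Bool → ℕ
𝟙 b = if b then 1 else 0

countBelow : (ℕ → Bool) → ℕ → ℕ
countBelow a i = Σ< i (𝟙 ∘ a)

countBelow-true : ∀ a i → a i ≡ true → countBelow a (suc i) ≡ suc (countBelow a i)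
countBelow-true a i ai =
  trans (Σ<-snoc i (𝟙 ∘ a)) (trans (cong (λ b → countBelow a i + 𝟙 b) ai) (+-comm _ 1))

countBelow-false : ∀ a i → a i ≡ false → countBelow a (suc i) ≡ countBelow a i
countBelow-false a i ai =
  trans (Σ<-snoc i (𝟙 ∘ a)) (trans (cong (λ b → countBelow a i + 𝟙 b) ai) (+-identityʳ _))

countBelow-mono : ∀ a {i i′} → i ≤ i′ → countBelow a i ≤ countBelow a i′
countBelow-mono a {i′ = zero}   z≤n = z≤n
countBelow-mono a {i′ = suc i′} i≤ with m≤n⇒m<n∨m≡n i≤
... | inj₂ refl        = ≤-refl
... | inj₁ (s≤s i≤i′) =
  ≤-trans (countBelow-mono a i≤i′)
          (subst (countBelow a i′ ≤_) (sym (Σ<-snoc i′ (𝟙 ∘ a))) (m≤m+n _ _))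

countBelow-strict : ∀ a {i i′} → a i ≡ true → i < i′ → countBelow a i < countBelow a i′
countBelow-strict a {i} {i′} ai i<i′ =
  subst (_≤ countBelow a i′) (countBelow-true a i ai) (countBelow-mono a i<i′)

Σ<-select-ascending : ∀ a N (Φ : ℕ → ℕ) →
  Σ< N (λ i → if a i then Φ (countBelow a i) else 0) ≡ Σ< (countBelow a N) Φ
Σ<-select-ascending a zero    Φ = refl
Σ<-select-ascending a (suc N) Φ = begin
  Σ< (suc N) (λ i → if a i then Φ (countBelow a i) else 0)
    ≡⟨ Σ<-snoc N _ ⟩
  Σ< N (λ i → if a i then Φ (countBelow a i) else 0) + (if a N then Φ (countBelow a N) else 0)
    ≡⟨ cong (_+ (if a N then Φ (countBelow a N) else 0)) (Σ<-select-ascending a N Φ) ⟩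
  Σ< (countBelow a N) Φ + (if a N then Φ (countBelow a N) else 0)
    ≡⟨ last (a N) refl ⟩
  Σ< (countBelow a (suc N)) Φ
    ∎
  where
  open ≡-Reasoning
  last : ∀ b → a N ≡ b →
    Σ< (countBelow a N) Φ + (if b then Φ (countBelow a N) else 0) ≡ Σ< (countBelow a (suc N)) Φ
  last true  aN = trans (sym (Σ<-snoc _ Φ)) (cong (λ l → Σ< l Φ) (sym (countBelow-true a N aN)))
  last false aN = trans (+-identityʳ _) (cong (λ l → Σ< l Φ) (sym (countBelow-false a N aN)))

Σ<-select-descending : ∀ a N (Φ : ℕ → ℕ) →
  Σ< N (λ i → if a i then Φ (countBelow a N ∸ countBelow a (suc i)) else 0) ≡ Σ< (countBelow a N) Φ
Σ<-select-descending a zero    Φ = refl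
Σ<-select-descending a (suc N) Φ = begin
  Σ< (suc N) (λ i → if a i then Φ (countBelow a (suc N) ∸ countBelow a (suc i)) else 0)
    ≡⟨ Σ<-snoc N _ ⟩
  Σ< N (λ i → if a i then Φ (countBelow a (suc N) ∸ countBelow a (suc i)) else 0)
    + (if a N then Φ (countBelow a (suc N) ∸ countBelow a (suc N)) else 0)
    ≡⟨ cong₂ _+_ (Σ<-cong N (λ i i<N → cong (λ l → if a i then Φ l else 0) (shift i i<N)))
                 (cong (λ l → if a N then Φ l else 0) (n∸n≡0 (countBelow a (suc N)))) ⟩
  Σ< N (λ i → if a i then Φ (𝟙 (a N) + (countBelow a N ∸ countBelow a (suc i))) else 0)
    + (if a N then Φ 0 else 0)
    ≡⟨ cong (_+ (if a N then Φ 0 else 0)) (Σ<-select-descending a N (λ s → Φ (𝟙 (a N) + s))) ⟩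
  Σ< (countBelow a N) (λ s → Φ (𝟙 (a N) + s)) + (if a N then Φ 0 else 0)
    ≡⟨ last (a N) refl ⟩
  Σ< (countBelow a (suc N)) Φ
    ∎
  where
  open ≡-Reasoning
  shift : ∀ i → i < N →
    countBelow a (suc N) ∸ countBelow a (suc i) ≡ 𝟙 (a N) + (countBelow a N ∸ countBelow a (suc i))
  shift i i<N = trans (cong (_∸ countBelow a (suc i)) (trans (Σ<-snoc N (𝟙 ∘ a)) (+-comm _ (𝟙 (a N)))))
                      (+-∸-assoc (𝟙 (a N)) (countBelow-mono a i<N))
  last : ∀ b → a N ≡ b →
    Σ< (countBelow a N) (λ s → Φ (𝟙 b + s)) + (if b then Φ 0 else 0) ≡ Σ< (countBelow a (suc N)) Φ
  last true  aN = trans (+-comm _ (Φ 0)) (cong (λ l → Σ< l Φ) (sym (countBelow-true a N aN)))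
  last false aN = trans (+-identityʳ _) (cong (λ l → Σ< l Φ) (sym (countBelow-false a N aN)))

-- Tables and the completion recursion

-- A table is indexed by (number of descents, number of negative entries).
Table : Set
Table = ℕ → ℕ → ℕ

infix 4 _≐_
_≐_ : Table → Table → Set
g ≐ h = ∀ k j → g k j ≡ h k j

infixl 6 _⊕_
_⊕_ : Table → Table → Table
(g ⊕ h) k j = g k j + h k j

Σᵀ : ℕ → (ℕ → Table) → Table
Σᵀ n h k j = Σ< n (λ s → h s k j)

shiftDes : Bool → Table → Table
shiftDes false g k       j = g k j
shiftDes true  g zero    j = 0
shiftDes true  g (suc k) j = g k j

shiftNeg : Bool → Table → Table
shiftNeg false g k j       = g k j
shiftNeg true  g k zero    = 0
shiftNeg true  g k (suc j) = g k j

↑des ↑neg : Table → Table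
↑des = shiftDes true
↑neg = shiftNeg true

shiftDes-cong : ∀ b {g h} → g ≐ h → shiftDes b g ≐ shiftDes b h
shiftDes-cong false g≐h k       j = g≐h k j
shiftDes-cong true  g≐h zero    j = refl
shiftDes-cong true  g≐h (suc k) j = g≐h k j

shiftNeg-cong : ∀ b {g h} → g ≐ h → shiftNeg b g ≐ shiftNeg b h
shiftNeg-cong false g≐h k j       = g≐h k j
shiftNeg-cong true  g≐h k zero    = refl
shiftNeg-cong true  g≐h k (suc j) = g≐h k j

shiftNeg-Σᵀ : ∀ b n h → shiftNeg b (Σᵀ n h) ≐ Σᵀ n (λ s → shiftNeg b (h s))
shiftNeg-Σᵀ false n h k j       = refl
shiftNeg-Σᵀ true  n h k zero    = sym (Σ<-zero n)
shiftNeg-Σᵀ true  n h k (suc j) = refl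

↑des↑neg-Σᵀ : ∀ n h → ↑des (↑neg (Σᵀ n h)) ≐ Σᵀ n (λ s → ↑des (↑neg (h s)))
↑des↑neg-Σᵀ n h zero    j = sym (Σ<-zero n)
↑des↑neg-Σᵀ n h (suc k) j = shiftNeg-Σᵀ true n h k j

-- The 2(m+1) unused signed letters are ordered by value, so the negative ones come
-- first.  Removing the letter of rank s together with its opposite leaves it with rank
-- s if it is negative (its opposite lies above it) and s − 1 if it is positive.
rankAfter : ℕ → ℕ → ℕ
rankAfter m s = if s <ᵇ suc m then s else s ∸ 1

rankAfter-suc : ∀ m s → rankAfter (suc m) (suc s) ≡ suc (rankAfter m s)
rankAfter-suc m zero = refl
rankAfter-suc m (suc s) with s <ᵇ m
... | true  = refl
... | false = refl

rankAfter-≤ : ∀ m s → s < suc m + suc m → rankAfter m s ≤ m + m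
rankAfter-≤ m zero    _  = z≤n
rankAfter-≤ m (suc s) s< with s <ᵇ m in eq
... | true  = ≤-trans (<ᵇ⇒< s m (subst T (sym eq) tt)) (m≤m+n m m)
... | false = ≤-pred (subst (suc s ≤_) (+-suc m m) (≤-pred s<))

rankAfter-positive : ∀ m c → rankAfter m (suc m + c) ≡ m + c
rankAfter-positive m c rewrite <ᵇ-false {suc m + c} {suc m} (m≤m+n (suc m) c) = refl

rankAfter-negative : ∀ m s → s < suc m → rankAfter m s ≡ s
rankAfter-negative m s s<1+m rewrite <ᵇ-true s<1+m = refl

unit : Table
unit zero    zero    = 1
unit zero    (suc j) = 0
unit (suc k) j       = 0

-- Completions m r counts the ways to write m more letters, using the m unused absolute
-- values, after a letter of rank r among the 2m unused signed letters.
mutual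
  Completions : ℕ → ℕ → Table
  Completions zero    r = unit
  Completions (suc m) r = Σᵀ (suc m + suc m) (λ s → shiftDes (s <ᵇ r) (afterLetter m s))

  afterLetter : ℕ → ℕ → Table
  afterLetter m s = shiftNeg (s <ᵇ suc m) (Completions m (rankAfter m s))

-- Counting words letter by letter

private variable
  S S′ : Set

count : (S → Bool) → List S → ℕ
count p []       = 0
count p (x ∷ xs) = 𝟙 (p x) + count p xs

length-filter≡count : ∀ {P : S → Set} (P? : ∀ x → Dec (P x)) xs →
  length (filter P? xs) ≡ count (does ∘ P?) xs
length-filter≡count P? []       = refl
length-filter≡count P? (x ∷ xs) with does (P? x)
... | true  = cong suc (length-filter≡count P? xs)
... | false = length-filter≡count P? xs

count-filter : ∀ {P : S → Set} (P? : ∀ x → Dec (P x)) (q : S → Bool) xs →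
  count q (filter P? xs) ≡ count (λ x → does (P? x) ∧ q x) xs
count-filter P? q []       = refl
count-filter P? q (x ∷ xs) with does (P? x)
... | true  = cong (_+_ (𝟙 (q x))) (count-filter P? q xs)
... | false = count-filter P? q xs

count-cong : ∀ {p q : S → Bool} xs → (∀ x → p x ≡ q x) → count p xs ≡ count q xs
count-cong []       p≗q = refl
count-cong (x ∷ xs) p≗q = cong₂ (λ b n → 𝟙 b + n) (p≗q x) (count-cong xs p≗q)

count-none : ∀ {p : S → Bool} xs → (∀ x → p x ≡ false) → count p xs ≡ 0
count-none []       none = refl
count-none (x ∷ xs) none rewrite none x = count-none xs none

count-++ : ∀ (p : S → Bool) xs ys → count p (xs ++ ys) ≡ count p xs + count p ys
count-++ p []       ys = refl
count-++ p (x ∷ xs) ys = trans (cong (_+_ (𝟙 (p x))) (count-++ p xs ys)) (sym (+-assoc (𝟙 (p x)) _ _))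

count-concatMap : ∀ (p : S′ → Bool) (g : S → List S′) xs →
  count p (concatMap g xs) ≡ sum (map (count p ∘ g) xs)
count-concatMap p g []       = refl
count-concatMap p g (x ∷ xs) =
  trans (count-++ p (g x) (concatMap g xs)) (cong (_+_ (count p (g x))) (count-concatMap p g xs))

count-map : ∀ (p : S′ → Bool) (g : S → S′) xs → count p (map g xs) ≡ count (p ∘ g) xs
count-map p g []       = refl
count-map p g (x ∷ xs) = cong (_+_ (𝟙 (p (g x)))) (count-map p g xs)

sum-map-applyUpTo : ∀ (h : S → ℕ) (g : ℕ → S) n → sum (map h (applyUpTo g n)) ≡ Σ< n (h ∘ g)
sum-map-applyUpTo h g zero    = refl
sum-map-applyUpTo h g (suc n) = cong (_+_ (h (g 0))) (sum-map-applyUpTo h (g ∘ suc) n)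

sum-map-entries : ∀ n (h : ℤ → ℕ) →
  sum (map h (entries n)) ≡ Σ< n (λ i → h (+ suc i)) + Σ< n (λ i → h -[1+ i ])
sum-map-entries n h = begin
  sum (map h (map (λ i → + suc i) (upTo n) ++ map -[1+_] (upTo n)))
    ≡⟨ cong sum (map-++ h (map (λ i → + suc i) (upTo n)) _) ⟩
  sum (map h (map (λ i → + suc i) (upTo n)) ++ map h (map -[1+_] (upTo n)))
    ≡⟨ sum-++ (map h (map (λ i → + suc i) (upTo n))) _ ⟩
  sum (map h (map (λ i → + suc i) (upTo n))) + sum (map h (map -[1+_] (upTo n)))
    ≡⟨ sym (cong₂ _+_ (cong sum (map-∘ (upTo n))) (cong sum (map-∘ (upTo n)))) ⟩
  sum (map (λ i → h (+ suc i)) (upTo n)) + sum (map (λ i → h -[1+ i ]) (upTo n))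
    ≡⟨ cong₂ _+_ (sum-map-applyUpTo _ (λ i → i) n) (sum-map-applyUpTo _ (λ i → i) n) ⟩
  Σ< n (λ i → h (+ suc i)) + Σ< n (λ i → h -[1+ i ])
    ∎
  where open ≡-Reasoning

uniqueᵇ : List ℕ → Bool
uniqueᵇ []       = true
uniqueᵇ (a ∷ as) = all (λ y → not (a ≡ᵇ y)) as ∧ uniqueᵇ as

does-all?-≢ : ∀ a ys → does (all? (λ y → ¬? (a ≟ y)) ys) ≡ all (λ y → not (a ≡ᵇ y)) ys
does-all?-≢ a []       = refl
does-all?-≢ a (y ∷ ys) = cong (not (a ≡ᵇ y) ∧_) (does-all?-≢ a ys)

does-unique? : ∀ ys → does (unique? ys) ≡ uniqueᵇ ys
does-unique? []       = refl
does-unique? (a ∷ as) = cong₂ _∧_ (does-all?-≢ a as) (does-unique? as)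

all-∧ : ∀ (p q : S → Bool) ys → all (λ y → p y ∧ q y) ys ≡ all p ys ∧ all q ys
all-∧ p q []       = refl
all-∧ p q (y ∷ ys) rewrite all-∧ p q ys = interchange (p y) (q y) (all p ys) (all q ys)
  where
  interchange : ∀ a b c d → (a ∧ b) ∧ (c ∧ d) ≡ (a ∧ c) ∧ (b ∧ d)
  interchange false b c d = refl
  interchange true  false c d = sym (∧-zeroʳ c)
  interchange true  true  c d = refl

all-cong : ∀ {p q : S → Bool} ys → (∀ y → p y ≡ q y) → all p ys ≡ all q ys
all-cong []       p≗q = refl
all-cong (y ∷ ys) p≗q = cong₂ _∧_ (p≗q y) (all-cong ys p≗q)

all-true : ∀ (ys : List S) → all (λ _ → true) ys ≡ true
all-true []       = refl
all-true (y ∷ ys) = all-true ys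

-- A predicate U : ℕ → Bool marks the absolute values already used.
use : (ℕ → Bool) → ℕ → ℕ → Bool
use U a y = (a ≡ᵇ y) ∨ U y

fresh : (ℕ → Bool) → List ℤ → Bool
fresh U []      = true
fresh U (x ∷ w) = not (U ∣ x ∣) ∧ fresh (use U ∣ x ∣) w

fresh-spec : ∀ U w → fresh U w ≡ all (not ∘ U) (map ∣_∣ w) ∧ uniqueᵇ (map ∣_∣ w)
fresh-spec U []      = refl
fresh-spec U (x ∷ w) = begin
  not (U a) ∧ fresh (use U a) w
    ≡⟨ cong (not (U a) ∧_) (fresh-spec (use U a) w) ⟩
  not (U a) ∧ (all (not ∘ use U a) as ∧ uniqueᵇ as)
    ≡⟨ cong (λ b → not (U a) ∧ (b ∧ uniqueᵇ as))
            (trans (all-cong as (λ y → not-∨ (a ≡ᵇ y) (U y))) (all-∧ _ _ as)) ⟩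
  not (U a) ∧ ((all (λ y → not (a ≡ᵇ y)) as ∧ all (not ∘ U) as) ∧ uniqueᵇ as)
    ≡⟨ regroup (not (U a)) (all (λ y → not (a ≡ᵇ y)) as) (all (not ∘ U) as) (uniqueᵇ as) ⟩
  (not (U a) ∧ all (not ∘ U) as) ∧ (all (λ y → not (a ≡ᵇ y)) as ∧ uniqueᵇ as)
    ∎
  where
  open ≡-Reasoning
  a = ∣ x ∣
  as = map ∣_∣ w
  not-∨ : ∀ b c → not (b ∨ c) ≡ not b ∧ not c
  not-∨ false c = refl
  not-∨ true  c = refl
  regroup : ∀ a b c d → a ∧ ((b ∧ c) ∧ d) ≡ (a ∧ c) ∧ (b ∧ d)
  regroup false b     c d = refl
  regroup true  false c d = sym (∧-zeroʳ c)
  regroup true  true  c d = refl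

neg-∷ : ∀ x w → neg (x ∷ w) ≡ 𝟙 (does (x ℤ.<? + 0)) + neg w
neg-∷ x w with does (x ℤ.<? + 0)
... | true  = refl
... | false = refl

count-shift : ∀ (b e : Bool) (q : S → Bool) (d g : S → ℕ) W k j →
  count (λ w → q w ∧ (((𝟙 b + d w) ≡ᵇ k) ∧ ((𝟙 e + g w) ≡ᵇ j))) W
    ≡ shiftDes b (shiftNeg e (λ k j → count (λ w → q w ∧ ((d w ≡ᵇ k) ∧ (g w ≡ᵇ j))) W)) k j
count-shift false false q d g W k       j       = refl
count-shift false true  q d g W k       zero    =
  count-none W (λ w → trans (cong (q w ∧_) (∧-zeroʳ _)) (∧-zeroʳ (q w)))
count-shift false true  q d g W k       (suc j) = refl
count-shift true  e     q d g W zero    j       = count-none W (λ w → ∧-zeroʳ (q w))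
count-shift true  false q d g W (suc k) j       = refl
count-shift true  true  q d g W (suc k) zero    =
  count-none W (λ w → trans (cong (q w ∧_) (∧-zeroʳ _)) (∧-zeroʳ (q w)))
count-shift true  true  q d g W (suc k) (suc j) = refl

unused : (ℕ → Bool) → ℕ → Bool
unused U i = not (U (suc i))

data UsedOrZero (U : ℕ → Bool) : ℤ → Set where
  zero-letter : UsedOrZero U (+ 0)
  used⁺       : ∀ i → U (suc i) ≡ true → UsedOrZero U (+ suc i)
  used⁻       : ∀ i → U (suc i) ≡ true → UsedOrZero U -[1+ i ]

countBelow-use-≤ : ∀ U i₀ N → N ≤ i₀ →
  countBelow (unused (use U (suc i₀))) N ≡ countBelow (unused U) N
countBelow-use-≤ U i₀ zero    _    = refl
countBelow-use-≤ U i₀ (suc N) N<i₀ =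
  trans (Σ<-snoc N _)
  (trans (cong₂ (λ c b → c + 𝟙 (not (b ∨ U (suc N))))
                (countBelow-use-≤ U i₀ N (<⇒≤ N<i₀)) (≡ᵇ-false (<⇒≢ N<i₀ ∘ sym)))
         (sym (Σ<-snoc N _)))

countBelow-use-> : ∀ U {i₀} → U (suc i₀) ≡ false → ∀ N → i₀ < N →
  suc (countBelow (unused (use U (suc i₀))) N) ≡ countBelow (unused U) N
countBelow-use-> U {i₀} i₀-unused (suc N) (s≤s i₀≤N) with m≤n⇒m<n∨m≡n i₀≤N
... | inj₂ refl =
  trans (cong suc (trans (Σ<-snoc N _)
                  (trans (cong (λ b → countBelow (unused (use U (suc N))) N + 𝟙 (not (b ∨ U (suc N))))
                               (≡ᵇ-refl N))
                         (+-identityʳ _))))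
  (trans (cong suc (countBelow-use-≤ U N N ≤-refl))
         (sym (countBelow-true (unused U) N (cong not i₀-unused))))
... | inj₁ i₀<N =
  trans (cong suc (Σ<-snoc N _))
  (trans (cong₂ (λ c b → c + 𝟙 (not (b ∨ U (suc N))))
                (countBelow-use-> U i₀-unused N i₀<N) (≡ᵇ-false (<⇒≢ i₀<N)))
         (sym (Σ<-snoc N _)))

module _ (n : ℕ) where

  wordCount : ℕ → (ℕ → Bool) → ℤ → Table
  wordCount m U p k j =
    count (λ w → fresh U w ∧ ((desFrom p w ≡ᵇ k) ∧ (neg w ≡ᵇ j))) (words m (entries n))

  B≡wordCount : ∀ k j → B n k j ≡ wordCount n (λ _ → false) (+ 0) k j
  B≡wordCount k j =
    trans (length-filter≡count _ (signedPerms n))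
    (trans (count-filter _ _ (words n (entries n)))
    (count-cong (words n (entries n))
                (λ w → cong (_∧ ((des w ≡ᵇ k) ∧ (neg w ≡ᵇ j))) (unique≡fresh w))))
    where
    unique≡fresh : ∀ w → does (unique? (map ∣_∣ w)) ≡ fresh (λ _ → false) w
    unique≡fresh w = trans (does-unique? (map ∣_∣ w))
      (sym (trans (fresh-spec (λ _ → false) w) (cong (_∧ uniqueᵇ (map ∣_∣ w)) (all-true (map ∣_∣ w)))))

  byFirstLetter : ℕ → (ℕ → Bool) → ℤ → ℕ → ℕ → ℤ → ℕ
  byFirstLetter m U p k j x =
    if U ∣ x ∣ then 0
    else shiftDes (does (x ℤ.<? p)) (shiftNeg (does (x ℤ.<? + 0)) (wordCount m (use U ∣ x ∣) x)) k j

  wordCount-suc : ∀ m U p k j → wordCount (suc m) U p k j ≡ sum (map (byFirstLetter m U p k j) (entries n))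
  wordCount-suc m U p k j =
    trans (count-concatMap _ (λ x → map (x ∷_) W) (entries n))
      (cong sum (map-cong (λ x → trans (count-map _ (x ∷_) W) (first x)) (entries n)))
    where
    W = words m (entries n)
    first : ∀ x →
      count (λ w → fresh U (x ∷ w) ∧ ((desFrom p (x ∷ w) ≡ᵇ k) ∧ (neg (x ∷ w) ≡ᵇ j))) W
                    ≡ byFirstLetter m U p k j x
    first x with U ∣ x ∣
    ... | true  = count-none W (λ w → refl)
    ... | false =
      trans (count-cong W (λ w → cong (λ l → fresh (use U ∣ x ∣) w ∧
                 (((𝟙 (does (x ℤ.<? p)) + desFrom x w) ≡ᵇ k) ∧ (l ≡ᵇ j))) (neg-∷ x w)))
            (count-shift (does (x ℤ.<? p)) (does (x ℤ.<? + 0)) (fresh (use U ∣ x ∣)) (desFrom x) neg W k j)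

  free : (ℕ → Bool) → ℕ
  free U = countBelow (unused U) n

  -- The number of unused signed letters below a letter; the free U negative ones come first.
  rank : (ℕ → Bool) → ℤ → ℕ
  rank U (+ zero)  = free U
  rank U (+ suc i) = free U + countBelow (unused U) i
  rank U -[1+ i ]  = free U ∸ countBelow (unused U) (suc i)

  <?-rank⁺ : ∀ U p → UsedOrZero U p → ∀ i → U (suc i) ≡ false →
    does (+ suc i ℤ.<? p) ≡ (rank U (+ suc i) <ᵇ rank U p)
  <?-rank⁺ U _ zero-letter i _ = sym (<ᵇ-false (m≤m+n (free U) _))
  <?-rank⁺ U _ (used⁺ i′ used) i i-unused with <-cmp i i′
  ... | tri< i<i′ _ _ =
    trans (<ᵇ-true i<i′)
      (sym (<ᵇ-true (+-monoʳ-< (free U) (countBelow-strict (unused U) (cong not i-unused) i<i′))))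
  ... | tri≈ _ refl _ = contradiction (trans (sym i-unused) used) λ ()
  ... | tri> _ _ i′<i =
    trans (<ᵇ-false (<⇒≤ i′<i))
      (sym (<ᵇ-false (+-monoʳ-≤ (free U) (countBelow-mono (unused U) (<⇒≤ i′<i)))))
  <?-rank⁺ U _ (used⁻ i′ _) i _ =
    sym (<ᵇ-false (≤-trans (m∸n≤m (free U) (countBelow (unused U) (suc i′)))
                           (m≤m+n (free U) (countBelow (unused U) i))))

  <?-rank⁻ : ∀ U p → UsedOrZero U p → ∀ i → i < n → U (suc i) ≡ false →
    does (-[1+ i ] ℤ.<? p) ≡ (rank U -[1+ i ] <ᵇ rank U p)
  <?-rank⁻ U p p-ok i i<n i-unused = against p p-ok
    where
    counted : countBelow (unused U) (suc i) ≡ suc (countBelow (unused U) i)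
    counted = countBelow-true (unused U) i (cong not i-unused)
    below-free : rank U -[1+ i ] < free U
    below-free = ∸-monoʳ-< (subst (0 <_) (sym counted) z<s) (countBelow-mono (unused U) i<n)
    against : ∀ p → UsedOrZero U p → does (-[1+ i ] ℤ.<? p) ≡ (rank U -[1+ i ] <ᵇ rank U p)
    against _ zero-letter  = sym (<ᵇ-true below-free)
    against _ (used⁺ _ _)  = sym (<ᵇ-true (≤-trans below-free (m≤m+n _ _)))
    against _ (used⁻ i′ used) with <-cmp i′ i
    ... | tri< i′<i _ _ =
      trans (<ᵇ-true i′<i)
        (sym (<ᵇ-true (∸-monoʳ-< (≤-trans (s≤s (countBelow-mono (unused U) i′<i))
                                          (≤-reflexive (sym counted)))
                                 (countBelow-mono (unused U) i<n))))
    ... | tri≈ _ refl _ = contradiction (trans (sym i-unused) used) λ ()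
    ... | tri> _ _ i<i′ =
      trans (<ᵇ-false (<⇒≤ i<i′))
        (sym (<ᵇ-false (∸-monoʳ-≤ (free U) (countBelow-mono (unused U) (s≤s (<⇒≤ i<i′))))))

  WordCountsMatch : ℕ → Set
  WordCountsMatch m = ∀ U p → UsedOrZero U p → free U ≡ m → wordCount m U p ≐ Completions m (rank U p)

  byFirstLetter⁺ : ∀ {m} → WordCountsMatch m → ∀ {U p} → UsedOrZero U p → free U ≡ suc m →
    ∀ k j i → i < n → byFirstLetter m U p k j (+ suc i)
      ≡ (if unused U i then shiftDes (rank U (+ suc i) <ᵇ rank U p) (afterLetter m (rank U (+ suc i))) k j else 0)
  byFirstLetter⁺ {m} match {U} {p} p-ok free≡ k j i i<n with U (suc i) in used
  ... | true  = refl
  ... | false =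
    trans (cong₂ (λ b c → shiftDes b (shiftNeg c (wordCount m U′ (+ suc i))) k j)
                 (<?-rank⁺ U p p-ok i used)
                 (sym (<ᵇ-false (subst (_≤ rank U (+ suc i)) free≡ (m≤m+n (free U) _)))))
          (shiftDes-cong (rank U (+ suc i) <ᵇ rank U p) (shiftNeg-cong (rank U (+ suc i) <ᵇ suc m) rest) k j)
    where
    U′ = use U (suc i)
    free′ : free U′ ≡ m
    free′ = suc-injective (trans (countBelow-use-> U used n i<n) free≡)
    rank′ : rank U′ (+ suc i) ≡ rankAfter m (rank U (+ suc i))
    rank′ = trans (cong₂ _+_ free′ (countBelow-use-≤ U i i ≤-refl))
                  (sym (subst (λ l → rankAfter m (l + countBelow (unused U) i) ≡ m + countBelow (unused U) i)
                              (sym free≡) (rankAfter-positive m (countBelow (unused U) i))))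
    rest : wordCount m U′ (+ suc i) ≐ Completions m (rankAfter m (rank U (+ suc i)))
    rest k′ j′ = trans (match U′ (+ suc i) (used⁺ i (cong (_∨ U (suc i)) (≡ᵇ-refl i))) free′ k′ j′)
                       (cong (λ r → Completions m r k′ j′) rank′)

  byFirstLetter⁻ : ∀ {m} → WordCountsMatch m → ∀ {U p} → UsedOrZero U p → free U ≡ suc m →
    ∀ k j i → i < n → byFirstLetter m U p k j -[1+ i ]
      ≡ (if unused U i then shiftDes (rank U -[1+ i ] <ᵇ rank U p) (afterLetter m (rank U -[1+ i ])) k j else 0)
  byFirstLetter⁻ {m} match {U} {p} p-ok free≡ k j i i<n with U (suc i) in used
  ... | true  = refl
  ... | false =
    trans (cong₂ (λ b c → shiftDes b (shiftNeg c (wordCount m U′ -[1+ i ])) k j)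
                 (<?-rank⁻ U p p-ok i i<n used) (sym (<ᵇ-true s<1+m)))
          (shiftDes-cong (s <ᵇ rank U p) (shiftNeg-cong (s <ᵇ suc m) rest) k j)
    where
    U′ = use U (suc i)
    s = rank U -[1+ i ]
    free′ : free U′ ≡ m
    free′ = suc-injective (trans (countBelow-use-> U used n i<n) free≡)
    s<1+m : s < suc m
    s<1+m = subst (s <_) free≡
      (∸-monoʳ-< (subst (0 <_) (sym (countBelow-true (unused U) i (cong not used))) z<s)
                 (countBelow-mono (unused U) i<n))
    rank′ : rank U′ -[1+ i ] ≡ rankAfter m s
    rank′ = trans (cong₂ _∸_ (countBelow-use-> U used n i<n) (countBelow-use-> U used (suc i) (n<1+n i)))
                  (sym (rankAfter-negative m s s<1+m))
    rest : wordCount m U′ -[1+ i ] ≐ Completions m (rankAfter m s)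
    rest k′ j′ = trans (match U′ -[1+ i ] (used⁻ i (cong (_∨ U (suc i)) (≡ᵇ-refl i))) free′ k′ j′)
                       (cong (λ r → Completions m r k′ j′) rank′)

  wordCount≐Completions : ∀ m → WordCountsMatch m
  wordCount≐Completions zero    U p _    _     zero    zero    = refl
  wordCount≐Completions zero    U p _    _     zero    (suc j) = refl
  wordCount≐Completions zero    U p _    _     (suc k) zero    = refl
  wordCount≐Completions zero    U p _    _     (suc k) (suc j) = refl
  wordCount≐Completions (suc m) U p p-ok free≡ k j = begin
    wordCount (suc m) U p k j
      ≡⟨ wordCount-suc m U p k j ⟩
    sum (map (byFirstLetter m U p k j) (entries n))
      ≡⟨ sum-map-entries n (byFirstLetter m U p k j) ⟩
    Σ< n (λ i → byFirstLetter m U p k j (+ suc i)) + Σ< n (λ i → byFirstLetter m U p k j -[1+ i ])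
      ≡⟨ cong₂ _+_ (Σ<-cong n (byFirstLetter⁺ IH p-ok free≡ k j))
                   (Σ<-cong n (byFirstLetter⁻ IH p-ok free≡ k j)) ⟩
    Σ< n (λ i → if unused U i then Ψ (free U + countBelow (unused U) i) else 0)
      + Σ< n (λ i → if unused U i then Ψ (free U ∸ countBelow (unused U) (suc i)) else 0)
      ≡⟨ cong₂ _+_ (Σ<-select-ascending (unused U) n (λ s → Ψ (free U + s)))
                   (Σ<-select-descending (unused U) n Ψ) ⟩
    Σ< (free U) (λ s → Ψ (free U + s)) + Σ< (free U) Ψ
      ≡⟨ all-letters (free U) free≡ ⟩
    Completions (suc m) (rank U p) k j
      ∎
    where
    open ≡-Reasoning
    IH = wordCount≐Completions m
    Ψ : ℕ → ℕ
    Ψ s = shiftDes (s <ᵇ rank U p) (afterLetter m s) k j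
    all-letters : ∀ M → M ≡ suc m →
      Σ< M (λ s → Ψ (M + s)) + Σ< M Ψ ≡ Completions (suc m) (rank U p) k j
    all-letters _ refl = trans (+-comm (Σ< (suc m) (λ s → Ψ (suc m + s))) _) (sym (Σ<-split (suc m) (suc m) Ψ))

countBelow-all : ∀ n → countBelow (λ _ → true) n ≡ n
countBelow-all zero    = refl
countBelow-all (suc n) = cong suc (countBelow-all n)

B≡Completions : ∀ n k j → B n k j ≡ Completions n n k j
B≡Completions n k j =
  trans (B≡wordCount n k j)
  (trans (wordCount≐Completions n n (λ _ → false) (+ 0) zero-letter (countBelow-all n) k j)
         (cong (λ r → Completions n r k j) (countBelow-all n)))


-- The four-term recurrence

zero-cell : ∀ k N → 0 + k * 0 + k * 0 ≡ suc k * 0 + N * 0 + k * 0 + suc N * 0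
zero-cell = solve-∀

-- A(k,j) = (k+1) g(k,j) + (N−k) g(k−1,j) + k g(k,j−1) + (N+1−k) g(k−1,j−1),
-- with the subtracted terms moved to the left so that no truncated subtraction occurs.
NextRow : ℕ → Table → Table → Set
NextRow N A g = ∀ k j →
  A k j + k * ↑des g k j + k * ↑des (↑neg g) k j
    ≡ suc k * g k j + N * ↑des g k j + k * ↑neg g k j + suc N * ↑des (↑neg g) k j

NextRow-congˡ : ∀ {N A A′ g} → A ≐ A′ → NextRow N A g → NextRow N A′ g
NextRow-congˡ {g = g} A≐A′ rec k j =
  trans (cong (λ a → a + k * ↑des g k j + k * ↑des (↑neg g) k j) (sym (A≐A′ k j))) (rec k j)

NextRow-congʳ : ∀ {N A g g′} → g ≐ g′ → NextRow N A g → NextRow N A g′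
NextRow-congʳ {g = g} {g′} g≐g′ rec k j
  rewrite sym (g≐g′ k j) | sym (shiftDes-cong true g≐g′ k j) | sym (shiftNeg-cong true g≐g′ k j)
        | sym (shiftDes-cong true (shiftNeg-cong true g≐g′) k j) = rec k j

NextRow-unique : ∀ {N A A′ g} → NextRow N A g → NextRow N A′ g → A ≐ A′
NextRow-unique {A = A} {A′} {g} rec rec′ k j =
  +-cancelʳ-≡ (k * ↑des g k j + k * ↑des (↑neg g) k j) (A k j) (A′ k j)
    (trans (sym (+-assoc (A k j) _ _)) (trans (rec k j) (trans (sym (rec′ k j)) (+-assoc (A′ k j) _ _))))

↑des-⊕ : ∀ g g′ → ↑des (g ⊕ g′) ≐ ↑des g ⊕ ↑des g′
↑des-⊕ g g′ zero    j = refl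
↑des-⊕ g g′ (suc k) j = refl

↑neg-⊕ : ∀ g g′ → ↑neg (g ⊕ g′) ≐ ↑neg g ⊕ ↑neg g′
↑neg-⊕ g g′ k zero    = refl
↑neg-⊕ g g′ k (suc j) = refl

↑des↑neg-⊕ : ∀ g g′ → ↑des (↑neg (g ⊕ g′)) ≐ ↑des (↑neg g) ⊕ ↑des (↑neg g′)
↑des↑neg-⊕ g g′ zero    j = refl
↑des↑neg-⊕ g g′ (suc k) j = ↑neg-⊕ g g′ k j

NextRow-⊕ : ∀ {N A A′ g g′} → NextRow N A g → NextRow N A′ g′ → NextRow N (A ⊕ A′) (g ⊕ g′)
NextRow-⊕ {N} {A} {A′} {g} {g′} rec rec′ k j
  rewrite ↑des-⊕ g g′ k j | ↑neg-⊕ g g′ k j | ↑des↑neg-⊕ g g′ k j =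
  add (A k j) (A′ k j) (g k j) (g′ k j) (↑des g k j) (↑des g′ k j)
      (↑neg g k j) (↑neg g′ k j) (↑des (↑neg g) k j) (↑des (↑neg g′) k j) (rec k j) (rec′ k j)
  where
  add : ∀ a a′ u u′ x x′ z z′ y y′ →
    a + k * x + k * y ≡ suc k * u + N * x + k * z + suc N * y →
    a′ + k * x′ + k * y′ ≡ suc k * u′ + N * x′ + k * z′ + suc N * y′ →
    a + a′ + k * (x + x′) + k * (y + y′)
      ≡ suc k * (u + u′) + N * (x + x′) + k * (z + z′) + suc N * (y + y′)
  add a a′ u u′ x x′ z z′ y y′ e e′ =
    trans (regroup a a′ x x′ y y′ k) (trans (cong₂ _+_ e e′) (collect u u′ x x′ z z′ y y′ k N))
    where
    regroup : ∀ a a′ x x′ y y′ k →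
      a + a′ + k * (x + x′) + k * (y + y′) ≡ (a + k * x + k * y) + (a′ + k * x′ + k * y′)
    regroup = solve-∀
    collect : ∀ u u′ x x′ z z′ y y′ k N →
      (suc k * u + N * x + k * z + suc N * y) + (suc k * u′ + N * x′ + k * z′ + suc N * y′)
        ≡ suc k * (u + u′) + N * (x + x′) + k * (z + z′) + suc N * (y + y′)
    collect = solve-∀

NextRow-zero : ∀ {N} → NextRow N (λ _ _ → 0) (λ _ _ → 0)
NextRow-zero {N} zero    j       = zero-cell 0 N
NextRow-zero {N} (suc k) zero    = zero-cell (suc k) N
NextRow-zero {N} (suc k) (suc j) = zero-cell (suc k) N

NextRow-Σᵀ : ∀ {N} n {A g : ℕ → Table} →
  (∀ s → s < n → NextRow N (A s) (g s)) → NextRow N (Σᵀ n A) (Σᵀ n g)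
NextRow-Σᵀ {N} zero    rec = NextRow-zero {N}
NextRow-Σᵀ {N} (suc n) rec =
  NextRow-⊕ {N} (rec 0 z<s) (NextRow-Σᵀ {N} n (λ s s<n → rec (suc s) (s<s s<n)))

↑neg↑des : ∀ g → ↑neg (↑des g) ≐ ↑des (↑neg g)
↑neg↑des g zero    zero    = refl
↑neg↑des g zero    (suc j) = refl
↑neg↑des g (suc k) zero    = refl
↑neg↑des g (suc k) (suc j) = refl

NextRow-shiftNeg : ∀ {N A g} b → NextRow N A g → NextRow N (shiftNeg b A) (shiftNeg b g)
NextRow-shiftNeg     false rec = rec
NextRow-shiftNeg {N} true  rec zero    zero    = zero-cell 0 N
NextRow-shiftNeg {N} true  rec (suc k) zero    = zero-cell (suc k) N
NextRow-shiftNeg     true  rec zero    (suc j) = rec zero j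
NextRow-shiftNeg     true  rec (suc k) (suc j) = rec (suc k) j

NextRow-shiftDes : ∀ {N A g} b → NextRow N A g →
  NextRow (suc N) (shiftDes b A ⊕ ↑des g ⊕ ↑des (↑neg g)) (shiftDes b g)
NextRow-shiftDes {N} {A} {g} false rec k j =
  trans (pad (A k j) (↑des g k j) (↑des (↑neg g) k j) k)
  (trans (cong (λ x → x + ↑des g k j + ↑des (↑neg g) k j) (rec k j))
         (collect (g k j) (↑des g k j) (↑neg g k j) (↑des (↑neg g) k j) k N))
  where
  pad : ∀ a x y k → a + x + y + k * x + k * y ≡ (a + k * x + k * y) + x + y
  pad = solve-∀
  collect : ∀ u x z y k N →
    suc k * u + N * x + k * z + suc N * y + x + y
      ≡ suc k * u + suc N * x + k * z + suc (suc N) * y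
  collect = solve-∀
NextRow-shiftDes {N} true rec zero j = zero-cell 0 (suc N)
NextRow-shiftDes {N} {A} {g} true rec (suc k) j
  rewrite ↑neg↑des g (suc k) j | ↑neg↑des g k j =
  trans (pad (A k j) (g k j) (↑neg g k j) (↑des g k j) (↑des (↑neg g) k j) k)
  (trans (cong (λ x → x + g k j + ↑neg g k j + ↑des g k j + ↑des (↑neg g) k j) (rec k j))
         (collect (g k j) (↑des g k j) (↑neg g k j) (↑des (↑neg g) k j) k N))
  where
  pad : ∀ a u z x y k →
    a + u + z + suc k * x + suc k * y ≡ (a + k * x + k * y) + u + z + x + y
  pad = solve-∀
  collect : ∀ u x z y k N →
    suc k * u + N * x + k * z + suc N * y + u + z + x + y
      ≡ suc (suc k) * u + suc N * x + suc k * z + suc (suc N) * y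
  collect = solve-∀

Completions-1-1 : NextRow 1 (Completions 1 1) (Completions 0 0)
Completions-1-1 zero          zero          = refl
Completions-1-1 zero          (suc zero)    = refl
Completions-1-1 zero          (suc (suc j)) = refl
Completions-1-1 (suc zero)    zero          = refl
Completions-1-1 (suc zero)    (suc zero)    = refl
Completions-1-1 (suc zero)    (suc (suc j)) = refl
Completions-1-1 (suc (suc k)) zero          = zero-cell (suc (suc k)) 1
Completions-1-1 (suc (suc k)) (suc j)       = zero-cell (suc (suc k)) 1

-- The smallest and the largest unused letter lead to tables that unfold one level
-- further; every other letter only moves the rank by one.
Completions-unfold : ∀ n r → r ≤ suc n + suc n →
  Completions (suc (suc n)) (suc r)
    ≐ Σᵀ (suc n + suc n) (λ s →
        shiftDes (s <ᵇ r) (shiftNeg (s <ᵇ suc n) (Completions (suc n) (suc (rankAfter n s))))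
        ⊕ ↑des (afterLetter n s) ⊕ ↑des (↑neg (afterLetter n s)))
Completions-unfold n r r≤ k j = begin
  term 0 + Σ< (m + suc m) (λ s → term (suc s))
    ≡⟨ cong (λ l → term 0 + Σ< l (λ s → term (suc s))) (+-suc m m) ⟩
  term 0 + Σ< (suc (m + m)) (λ s → term (suc s))
    ≡⟨ cong (_+_ (term 0)) (Σ<-snoc (m + m) (λ s → term (suc s))) ⟩
  term 0 + (Σ< (m + m) (λ s → term (suc s)) + term (suc (m + m)))
    ≡⟨ cong₂ (λ x y → x + (y + term (suc (m + m))))
             (↑des↑neg-Σᵀ (m + m) (afterLetter n) k j) (Σ<-cong (m + m) (λ s _ → middle s)) ⟩
  Σ< (m + m) withDesNeg + (Σ< (m + m) kept + term (suc (m + m)))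
    ≡⟨ cong (λ x → Σ< (m + m) withDesNeg + (Σ< (m + m) kept + x)) last ⟩
  Σ< (m + m) withDesNeg + (Σ< (m + m) kept + Σ< (m + m) withDes)
    ≡⟨ +-comm (Σ< (m + m) withDesNeg) _ ⟩
  Σ< (m + m) kept + Σ< (m + m) withDes + Σ< (m + m) withDesNeg
    ≡⟨ sym (trans (Σ<-+ (m + m) (λ s → kept s + withDes s) withDesNeg)
                  (cong (_+ Σ< (m + m) withDesNeg) (Σ<-+ (m + m) kept withDes))) ⟩
  Σ< (m + m) (λ s → kept s + withDes s + withDesNeg s)
    ∎
  where
  open ≡-Reasoning
  m = suc n
  term withDesNeg kept withDes : ℕ → ℕ
  term s = shiftDes (s <ᵇ suc r) (afterLetter m s) k j
  withDesNeg s = ↑des (↑neg (afterLetter n s)) k j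
  kept s = shiftDes (s <ᵇ r) (shiftNeg (s <ᵇ m) (Completions m (suc (rankAfter n s)))) k j
  withDes s = ↑des (afterLetter n s) k j
  middle : ∀ s → term (suc s) ≡ kept s
  middle s = cong (λ t → shiftDes (s <ᵇ r) (shiftNeg (s <ᵇ m) (Completions m t)) k j) (rankAfter-suc n s)
  last : term (suc (m + m)) ≡ Σ< (m + m) withDes
  last rewrite <ᵇ-false {m + m} r≤ | <ᵇ-false {m + m} (m≤m+n m m) =
    Σ<-cong (m + m) (λ s s< → cong (λ b → shiftDes b (afterLetter n s) k j) (<ᵇ-true s<))

Completions-nextRow : ∀ n r → r ≤ n + n → NextRow (suc n) (Completions (suc n) (suc r)) (Completions n r)
Completions-nextRow zero    zero r≤ = Completions-1-1
Completions-nextRow (suc n) r    r≤ =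
  NextRow-congˡ {suc (suc n)} (λ k j → sym (Completions-unfold n r r≤ k j))
    (NextRow-Σᵀ {suc (suc n)} (suc n + suc n) (λ s s< →
      NextRow-shiftDes {suc n} (s <ᵇ r) (NextRow-shiftNeg {suc n} (s <ᵇ suc n)
        (Completions-nextRow n (rankAfter n s) (rankAfter-≤ n s s<)))))

-- Descents with a prescribed number of negative letters

prev : (ℕ → ℕ) → ℕ → ℕ
prev a zero    = 0
prev a (suc k) = a k

Bounded : ℕ → (ℕ → ℕ) → Set
Bounded n a = ∀ k → n < k → a k ≡ 0

insertPos insertNeg : ℕ → (ℕ → ℕ) → ℕ → ℕ
insertPos n a zero    = a 0
insertPos n a (suc k) = suc (suc k) * a (suc k) + (n ∸ k) * a k
insertNeg n a zero    = 0
insertNeg n a (suc k) = suc k * a (suc k) + (suc n ∸ k) * a k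

-- B(n,k,j) = (n C j) · fixedNeg n j k (see B≡binomial); the values for j > n are junk.
fixedNeg : ℕ → ℕ → ℕ → ℕ
fixedNeg zero    j zero    = 1
fixedNeg zero    j (suc k) = 0
fixedNeg (suc n) j k =
  (if j ≤ᵇ n then insertPos n (fixedNeg n j) else insertNeg n (fixedNeg n (j ∸ 1))) k

-- The recurrences defining insertPos n a and insertNeg n a, with the subtracted terms
-- moved to the left.
PosStep NegStep : ℕ → (ℕ → ℕ) → (ℕ → ℕ) → Set
PosStep n a b = ∀ k → b k + k * prev a k ≡ suc k * a k + suc n * prev a k
NegStep n a b = ∀ k → b k + k * prev a k ≡ k * a k + suc (suc n) * prev a k

insertPos-bounded : ∀ {n a} → Bounded n a → Bounded (suc n) (insertPos n a)
insertPos-bounded {n} {a} a-bd (suc k) (s<s n<k)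
  rewrite a-bd (suc k) (m<n⇒m<1+n n<k) | a-bd k n<k =
  cong₂ _+_ (*-zeroʳ (suc (suc k))) (*-zeroʳ (n ∸ k))

insertNeg-bounded : ∀ {n a} → Bounded n a → Bounded (suc n) (insertNeg n a)
insertNeg-bounded {n} {a} a-bd (suc k) (s<s n<k)
  rewrite a-bd (suc k) (m<n⇒m<1+n n<k) | a-bd k n<k =
  cong₂ _+_ (*-zeroʳ (suc k)) (*-zeroʳ (suc n ∸ k))

fixedNeg-bounded : ∀ n j → Bounded n (fixedNeg n j)
fixedNeg-bounded zero    j (suc k) _ = refl
fixedNeg-bounded (suc n) j k n<k with j ≤ᵇ n
... | true  = insertPos-bounded (fixedNeg-bounded n j) k n<k
... | false = insertNeg-bounded (fixedNeg-bounded n (j ∸ 1)) k n<k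

∸-split : ∀ N k x → k ≤ N ⊎ x ≡ 0 → (N ∸ k) * x + suc k * x ≡ suc N * x
∸-split N k x (inj₁ k≤N) =
  trans (sym (*-distribʳ-+ x (N ∸ k) (suc k)))
        (cong (_* x) (trans (+-suc (N ∸ k) k) (cong suc (m∸n+n≡m k≤N))))
∸-split N k x (inj₂ refl) = trans (cong₂ _+_ (*-zeroʳ (N ∸ k)) (*-zeroʳ (suc k))) (sym (*-zeroʳ (suc N)))

bounded-∸-split : ∀ {n a} N → n ≤ N → Bounded n a →
  ∀ k → (N ∸ k) * a k + suc k * a k ≡ suc N * a k
bounded-∸-split {n} {a} N n≤N a-bd k with k ≤? N
... | yes k≤N = ∸-split N k (a k) (inj₁ k≤N)
... | no  k≰N = ∸-split N k (a k) (inj₂ (a-bd k (≤-<-trans n≤N (≰⇒> k≰N))))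

insertPos-step : ∀ {n a} → Bounded n a → PosStep n a (insertPos n a)
insertPos-step {n} {a} a-bd zero    = zeroCase (a 0) n
  where
  zeroCase : ∀ x n → x + 0 * 0 ≡ 1 * x + suc n * 0
  zeroCase = solve-∀
insertPos-step {n} {a} a-bd (suc k) =
  trans (+-assoc (suc (suc k) * a (suc k)) _ _)
        (cong (_+_ (suc (suc k) * a (suc k))) (bounded-∸-split n ≤-refl a-bd k))

insertNeg-step : ∀ {n a} → Bounded n a → NegStep n a (insertNeg n a)
insertNeg-step {n} {a} a-bd zero    = zeroCase (a 0) n
  where
  zeroCase : ∀ x n → 0 + 0 * 0 ≡ 0 * x + suc (suc n) * 0
  zeroCase = solve-∀
insertNeg-step {n} {a} a-bd (suc k) =
  trans (+-assoc (suc k * a (suc k)) _ _)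
        (cong (_+_ (suc k * a (suc k))) (bounded-∸-split (suc n) (n≤1+n n) a-bd k))

-- Inserting a positive and a negative letter commute.  The conclusion is a linear
-- combination of the hypotheses, so both sides are padded until they agree as polynomials.
pos-neg-commute : ∀ {n a b c d} →
  NegStep n a b → PosStep n a c → PosStep (suc n) b d → NegStep (suc n) c d
pos-neg-commute {n} {a} {b} {c} {d} negB posC posD zero = begin
  d 0 + 0 * 0                      ≡⟨ posD 0 ⟩
  1 * b 0 + suc (suc n) * 0        ≡⟨ unit-coeff (b 0) n ⟩
  b 0 + 0 * 0                      ≡⟨ negB 0 ⟩
  0 * a 0 + suc (suc n) * 0        ≡⟨ zero-coeff (a 0) (c 0) n ⟩
  0 * c 0 + suc (suc (suc n)) * 0  ∎
  where
  open ≡-Reasoning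
  unit-coeff : ∀ x n → 1 * x + suc (suc n) * 0 ≡ x + 0 * 0
  unit-coeff = solve-∀
  zero-coeff : ∀ x y n → 0 * x + suc (suc n) * 0 ≡ 0 * y + suc (suc (suc n)) * 0
  zero-coeff = solve-∀
pos-neg-commute {n} {a} {b} {c} {d} negB posC posD (suc k) =
  +-cancelʳ-≡ R _ _
    (trans (pad (d (suc k)) (b (suc k)) (b k) (c (suc k)) (c k) (a (suc k)) (a k) (prev a k) k n)
           (cong (_+_ (suc k * c (suc k) + suc (suc (suc n)) * c k)) L≡R))
  where
  L R : ℕ
  L = (d (suc k) + suc k * b k) + suc (suc k) * (b (suc k) + suc k * a k)
      + suc (suc n) * (b k + k * prev a k) + suc k * (k * a k + suc (suc n) * prev a k)
      + suc k * (suc (suc k) * a (suc k) + suc n * a k) + suc k * (c k + k * prev a k)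
      + suc (suc (suc n)) * (suc k * a k + suc n * prev a k)
  R = (suc (suc k) * b (suc k) + suc (suc n) * b k) + suc (suc k) * (suc k * a (suc k) + suc (suc n) * a k)
      + suc (suc n) * (k * a k + suc (suc n) * prev a k) + suc k * (b k + k * prev a k)
      + suc k * (c (suc k) + suc k * a k) + suc k * (suc k * a k + suc n * prev a k)
      + suc (suc (suc n)) * (c k + k * prev a k)
  L≡R : L ≡ R
  L≡R = cong₂ _+_ (cong₂ _+_ (cong₂ _+_ (cong₂ _+_ (cong₂ _+_ (cong₂ _+_
          (posD (suc k)) (cong (suc (suc k) *_) (negB (suc k)))) (cong (suc (suc n) *_) (negB k)))
          (cong (suc k *_) (sym (negB k)))) (cong (suc k *_) (sym (posC (suc k)))))
          (cong (suc k *_) (posC k))) (cong (suc (suc (suc n)) *_) (sym (posC k)))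
  pad : ∀ d₁ b₁ b₀ c₁ c₀ a₁ a₀ a₋ k n →
    d₁ + suc k * c₀ + ((suc (suc k) * b₁ + suc (suc n) * b₀) + suc (suc k) * (suc k * a₁ + suc (suc n) * a₀)
      + suc (suc n) * (k * a₀ + suc (suc n) * a₋) + suc k * (b₀ + k * a₋)
      + suc k * (c₁ + suc k * a₀) + suc k * (suc k * a₀ + suc n * a₋)
      + suc (suc (suc n)) * (c₀ + k * a₋))
    ≡ suc k * c₁ + suc (suc (suc n)) * c₀ + ((d₁ + suc k * b₀) + suc (suc k) * (b₁ + suc k * a₀)
      + suc (suc n) * (b₀ + k * a₋) + suc k * (k * a₀ + suc (suc n) * a₋)
      + suc k * (suc (suc k) * a₁ + suc n * a₀) + suc k * (c₀ + k * a₋)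
      + suc (suc (suc n)) * (suc k * a₀ + suc n * a₋))
  pad = solve-∀

fixedNeg-pos : ∀ {n j} → j ≤ n → PosStep n (fixedNeg n j) (fixedNeg (suc n) j)
fixedNeg-pos {n} {j} j≤n k rewrite ≤ᵇ-true j≤n = insertPos-step (fixedNeg-bounded n j) k

fixedNeg-neg : ∀ {n j} → j ≤ n → NegStep n (fixedNeg n j) (fixedNeg (suc n) (suc j))
fixedNeg-neg {n} {j} j≤n with m≤n⇒m<n∨m≡n j≤n
... | inj₂ refl = lastRow
  where
  lastRow : NegStep n (fixedNeg n n) (fixedNeg (suc n) (suc n))
  lastRow k rewrite <ᵇ-false {n} {n} ≤-refl = insertNeg-step (fixedNeg-bounded n n) k
fixedNeg-neg {suc n} {j} _ | inj₁ (s≤s j≤n) =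
  pos-neg-commute {n} (fixedNeg-neg j≤n) (fixedNeg-pos j≤n) (fixedNeg-pos (s≤s j≤n))

C-absorb : ∀ m j → suc j * (suc m C suc j) ≡ suc m * (m C j)
C-absorb m       zero    = trans (*-identityˡ _) (trans (nC1≡n (suc m)) (sym (*-identityʳ (suc m))))
C-absorb zero    (suc j) = *-zeroʳ (suc (suc j))
C-absorb (suc m) (suc j) = begin
  suc (suc j) * (suc (suc m) C suc (suc j))
    ≡⟨ cong (suc (suc j) *_) (sym (nCk+nC[k+1]≡[n+1]C[k+1] (suc m) (suc j))) ⟩
  suc (suc j) * (y + suc m C suc (suc j))
    ≡⟨ *-distribˡ-+ (suc (suc j)) y _ ⟩
  y + suc j * y + suc (suc j) * (suc m C suc (suc j))
    ≡⟨ cong₂ (λ u v → y + u + v) (C-absorb m j) (C-absorb m (suc j)) ⟩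
  y + suc m * (m C j) + suc m * (m C suc j)
    ≡⟨ trans (+-assoc y _ _) (cong (_+_ y) (sym (*-distribˡ-+ (suc m) (m C j) _))) ⟩
  y + suc m * (m C j + m C suc j)
    ≡⟨ cong (λ t → y + suc m * t) (nCk+nC[k+1]≡[n+1]C[k+1] m j) ⟩
  suc (suc m) * y
    ∎
  where
  open ≡-Reasoning
  y = suc m C suc j

C-complement : ∀ m j → j ≤ suc m → (suc m ∸ j) * (suc m C j) ≡ suc m * (m C j)
C-complement m zero    _         = refl
C-complement m (suc j) (s≤s j≤m) = +-cancelʳ-≡ (suc m * (m C j)) _ _ (begin
  (m ∸ j) * x + suc m * (m C j)      ≡⟨ cong (_+_ ((m ∸ j) * x)) (sym (C-absorb m j)) ⟩
  (m ∸ j) * x + suc j * x            ≡⟨ ∸-split m j x (inj₁ j≤m) ⟩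
  suc m * x                          ≡⟨ cong (suc m *_) (sym (nCk+nC[k+1]≡[n+1]C[k+1] m j)) ⟩
  suc m * (m C j + m C suc j)        ≡⟨ *-distribˡ-+ (suc m) (m C j) _ ⟩
  suc m * (m C j) + suc m * (m C suc j) ≡⟨ +-comm (suc m * (m C j)) _ ⟩
  suc m * (m C suc j) + suc m * (m C j) ∎)
  where
  open ≡-Reasoning
  x = suc m C suc j

binomialTable : ℕ → Table
binomialTable n k j = (n C j) * fixedNeg n j k

↑des-binomialTable : ∀ n k j → ↑des (binomialTable n) k j ≡ (n C j) * prev (fixedNeg n j) k
↑des-binomialTable n zero    j = sym (*-zeroʳ (n C j))
↑des-binomialTable n (suc k) j = refl

↑des↑neg-binomialTable : ∀ n k j →
  ↑des (↑neg (binomialTable n)) k (suc j) ≡ (n C j) * prev (fixedNeg n j) k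
↑des↑neg-binomialTable n zero    j = sym (*-zeroʳ (n C j))
↑des↑neg-binomialTable n (suc k) j = refl

↑des↑neg-zero : ∀ g k → ↑des (↑neg g) k 0 ≡ 0
↑des↑neg-zero g zero    = refl
↑des↑neg-zero g (suc k) = refl

scaled : ∀ c {x y} → c ≡ 0 ⊎ x ≡ y → c * x ≡ c * y
scaled c (inj₁ refl) = refl
scaled c (inj₂ refl) = refl

binomialTable-nextRow : ∀ n → NextRow (suc n) (binomialTable (suc n)) (binomialTable n)
binomialTable-nextRow n k zero
  rewrite ↑des-binomialTable n k 0 | ↑des↑neg-zero (binomialTable n) k =
  trans (drop-unit X Y′ k) (trans (fixedNeg-pos z≤n k) (add-unit Y Y′ k n))
  where
  X = fixedNeg (suc n) 0 k
  Y = fixedNeg n 0 k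
  Y′ = prev (fixedNeg n 0) k
  drop-unit : ∀ X Y′ k → 1 * X + k * (1 * Y′) + k * 0 ≡ X + k * Y′
  drop-unit = solve-∀
  add-unit : ∀ Y Y′ k n →
    suc k * Y + suc n * Y′ ≡ suc k * (1 * Y) + suc n * (1 * Y′) + k * 0 + suc (suc n) * 0
  add-unit = solve-∀
-- Pascal's rule splits the new entry according to the sign of the new absolute value n + 1.
binomialTable-nextRow n k (suc j)
  rewrite ↑des-binomialTable n k (suc j) | ↑des↑neg-binomialTable n k j
        | sym (nCk+nC[k+1]≡[n+1]C[k+1] n j) =
  trans (split (n C suc j) (n C j) X Y′ Z′ k)
        (trans (cong₂ _+_ posPart negPart) (merge (n C suc j) (n C j) Y Y′ Z Z′ k n))
  where
  X = fixedNeg (suc n) (suc j) k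
  Y = fixedNeg n (suc j) k
  Y′ = prev (fixedNeg n (suc j)) k
  Z = fixedNeg n j k
  Z′ = prev (fixedNeg n j) k
  posPart : (n C suc j) * (X + k * Y′) ≡ (n C suc j) * (suc k * Y + suc n * Y′)
  posPart with suc j ≤? n
  ... | yes j<n = scaled (n C suc j) (inj₂ (fixedNeg-pos j<n k))
  ... | no  j≮n = scaled (n C suc j) (inj₁ (k>n⇒nCk≡0 (≰⇒> j≮n)))
  negPart : (n C j) * (X + k * Z′) ≡ (n C j) * (k * Z + suc (suc n) * Z′)
  negPart with j ≤? n
  ... | yes j≤n = scaled (n C j) (inj₂ (fixedNeg-neg j≤n k))
  ... | no  j≰n = scaled (n C j) (inj₁ (k>n⇒nCk≡0 (≰⇒> j≰n)))
  split : ∀ c c′ X Y′ Z′ k →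
    (c′ + c) * X + k * (c * Y′) + k * (c′ * Z′) ≡ c * (X + k * Y′) + c′ * (X + k * Z′)
  split = solve-∀
  merge : ∀ c c′ Y Y′ Z Z′ k n →
    c * (suc k * Y + suc n * Y′) + c′ * (k * Z + suc (suc n) * Z′)
      ≡ suc k * (c * Y) + suc n * (c * Y′) + k * (c′ * Z) + suc (suc n) * (c′ * Z′)
  merge = solve-∀

Completions≐binomialTable : ∀ n → Completions n n ≐ binomialTable n
Completions≐binomialTable zero    zero    zero    = refl
Completions≐binomialTable zero    zero    (suc j) = refl
Completions≐binomialTable zero    (suc k) j       = sym (*-zeroʳ (0 C j))
Completions≐binomialTable (suc n) =
  NextRow-unique {suc n}
    (NextRow-congʳ {suc n} (Completions≐binomialTable n) (Completions-nextRow n n (m≤m+n n n)))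
    (binomialTable-nextRow n)

-- The recurrences for B

B≡binomial : ∀ n k j → B n k j ≡ (n C j) * fixedNeg n j k
B≡binomial n k j = trans (B≡Completions n k j) (Completions≐binomialTable n k j)

Bℤ-prev : ∀ m k j → Bℤ m (+ k - + 1) (+ j) ≡ (m C j) * prev (fixedNeg m j) k
Bℤ-prev m zero    j = sym (*-zeroʳ (m C j))
Bℤ-prev m (suc k) j = B≡binomial m k j

solve-∸ : ∀ {x y z} k N → k ≤ N → x + k * z ≡ y + N * z → x ≡ y + (N ∸ k) * z
solve-∸ {x} {y} {z} k N k≤N eq = +-cancelʳ-≡ (k * z) x _ (begin
  x + k * z                  ≡⟨ eq ⟩
  y + N * z                  ≡⟨ cong (λ l → y + l * z) (sym (m∸n+n≡m k≤N)) ⟩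
  y + (N ∸ k + k) * z        ≡⟨ distribute y (N ∸ k) k z ⟩
  y + (N ∸ k) * z + k * z    ∎)
  where
  open ≡-Reasoning
  distribute : ∀ y a b z → y + (a + b) * z ≡ y + a * z + b * z
  distribute = solve-∀

B-recurrence-pos : ∀ m k j → k ≤ suc m → j ≤ m →
  (suc m ∸ j) * B (suc m) k j
    ≡ (k + 1) * suc m * B m k j + (suc m ∸ k) * suc m * Bℤ m (+ k - + 1) (+ j)
B-recurrence-pos m k j k≤n j≤m = begin
  (n ∸ j) * B n k j
    ≡⟨ cong ((n ∸ j) *_) (B≡binomial n k j) ⟩
  (n ∸ j) * ((n C j) * fixedNeg n j k)
    ≡⟨ sym (*-assoc (n ∸ j) (n C j) _) ⟩
  (n ∸ j) * (n C j) * fixedNeg n j k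
    ≡⟨ cong₂ _*_ (C-complement m j (m≤n⇒m≤1+n j≤m))
                 (solve-∸ {z = Y′} k n k≤n (fixedNeg-pos j≤m k)) ⟩
  n * (m C j) * (suc k * Y + (n ∸ k) * Y′)
    ≡⟨ spread n (m C j) Y Y′ k (n ∸ k) ⟩
  (k + 1) * n * ((m C j) * Y) + (n ∸ k) * n * ((m C j) * Y′)
    ≡⟨ cong₂ (λ a b → (k + 1) * n * a + (n ∸ k) * n * b)
             (sym (B≡binomial m k j)) (sym (Bℤ-prev m k j)) ⟩
  (k + 1) * n * B m k j + (n ∸ k) * n * Bℤ m (+ k - + 1) (+ j)
    ∎
  where
  open ≡-Reasoning
  n = suc m
  Y = fixedNeg m j k
  Y′ = prev (fixedNeg m j) k
  spread : ∀ n c y y′ k d → n * c * (suc k * y + d * y′) ≡ (k + 1) * n * (c * y) + d * n * (c * y′)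
  spread = solve-∀

B-recurrence-neg : ∀ m k j → k ≤ suc m → j ≤ m →
  suc j * B (suc m) k (suc j)
    ≡ k * suc m * B m k j + (suc m ∸ k + 1) * suc m * Bℤ m (+ k - + 1) (+ j)
B-recurrence-neg m k j k≤n j≤m = begin
  suc j * B n k (suc j)
    ≡⟨ cong (suc j *_) (B≡binomial n k (suc j)) ⟩
  suc j * ((n C suc j) * fixedNeg n (suc j) k)
    ≡⟨ sym (*-assoc (suc j) (n C suc j) _) ⟩
  suc j * (n C suc j) * fixedNeg n (suc j) k
    ≡⟨ cong₂ _*_ (C-absorb m j)
                 (solve-∸ {z = Z′} k (suc n) (m≤n⇒m≤1+n k≤n) (fixedNeg-neg j≤m k)) ⟩
  n * (m C j) * (k * Z + (suc n ∸ k) * Z′)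
    ≡⟨ cong (λ d → n * (m C j) * (k * Z + d * Z′)) (trans (+-∸-assoc 1 k≤n) (+-comm 1 (n ∸ k))) ⟩
  n * (m C j) * (k * Z + (n ∸ k + 1) * Z′)
    ≡⟨ spread n (m C j) Z Z′ k (n ∸ k + 1) ⟩
  k * n * ((m C j) * Z) + (n ∸ k + 1) * n * ((m C j) * Z′)
    ≡⟨ cong₂ (λ a b → k * n * a + (n ∸ k + 1) * n * b)
             (sym (B≡binomial m k j)) (sym (Bℤ-prev m k j)) ⟩
  k * n * B m k j + (n ∸ k + 1) * n * Bℤ m (+ k - + 1) (+ j)
    ∎
  where
  open ≡-Reasoning
  n = suc m
  Z = fixedNeg m j k
  Z′ = prev (fixedNeg m j) k
  spread : ∀ n c z z′ k d → n * c * (k * z + d * z′) ≡ k * n * (c * z) + d * n * (c * z′)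
  spread = solve-∀

corollary5p2 : (n k j : ℕ) → 1 ≤ n → k ≤ n → j ≤ n →
    (j < n → (n ∸ j) * B n k j
    ≡ (k + 1) * n * Bℤ (n ∸ 1) (+ k) (+ j)
    + (n ∸ k) * n * Bℤ (n ∸ 1) (+ k - + 1) (+ j))
    × (0 < j → j * B n k j
    ≡ k * n * Bℤ (n ∸ 1) (+ k) (+ j - + 1)
    + (n ∸ k + 1) * n * Bℤ (n ∸ 1) (+ k - + 1) (+ j - + 1))
corollary5p2 (suc m) k zero    _ k≤n _          = (λ _ → B-recurrence-pos m k 0 k≤n z≤n) , λ ()
corollary5p2 (suc m) k (suc j) _ k≤n (s≤s j≤m) =
  (λ { (s≤s j<m) → B-recurrence-pos m k (suc j) k≤n j<m }) , λ _ → B-recurrence-neg m k j k≤n j≤m
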